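{- Every regular infinite tree set contains either an $\omega$-chain or an infinite splitting star.
   Context: A separation system is a triple $(\vec S,\le,*)$ with $(\vec S,\le)$ a poset and $*$ an order-reversing involution ($\vec s\mapsto\overleftarrow s$, with $\vec r\le\vec s\iff\overleftarrow r\ge\overleftarrow s$). Separations are the pairs $s=\{\vec s,\overleftarrow s\}$; $S$ is the set of separations. Two separations are nested if they have comparable orientations. An element $\vec r$ is degenerate if $\vec r=\overleftarrow r$, trivial if there is $s\in S$, $s\ne r$, with $\vec r<\vec s$ and $\vec r<\overleftarrow s$, and small if $\vec r\le\overleftarrow r$. A tree set is a separation system in which every two separations are nested and no element is degenerate or trivial; it is regular if it has no small elements. An orientation of $S$ contains exactly one of $\vec s,\overleftarrow s$ for each $s$; it is consistent if there are no distinct $r,s$ with orientations $\vec r<\vec s$ such that $\overleftarrow r$ and $\vec s$ both lie in it. A star is a subset $\sigma\subseteq\vec S$ with $\vec r\le\overleftarrow s$ for all distinct $\vec r,\vec s\in\sigma$. A splitting star is a star $\sigma$ which is the set of maximal elements of a consistent orientation $O$ of $S$ such that $O$ equals the down-closure $\{\vec r\in\vec S:\exists\vec s\in\sigma,\vec r\le\vec s\}$. An $\omega$-chain is a chain order-isomorphic to $\omega$. -}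

module Defs where

open import Level using (Level; _⊔_) renaming (suc to lsuc; zero to lzero)
open import Data.Nat using (ℕ) renaming (_<_ to _<ℕ_)
open import Data.Fin using (Fin)
open import Data.Product using (Σ; _×_; _,_; ∃; ∃-syntax)
open import Data.Sum using (_⊎_)
open import Data.Unit using (⊤)
open import Function.Bundles using (_⇔_)
open import Relation.Nullary using (¬_)
open import Relation.Unary using (Pred)
open import Relation.Binary.PropositionalEquality using (_≡_; _≢_)
open import Relation.Binary.Structures using (IsPartialOrder)
open import Axiom.ExcludedMiddle public using (ExcludedMiddle)

record SeparationSystem : Set₁ where
  field
    Carrier        : Set                       -- the set S⃗ of oriented separations
    _≤_            : Carrier → Carrier → Set
    isPartialOrder : IsPartialOrder _≡_ _≤_
    _*             : Carrier → Carrier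
    *-involutive   : ∀ r → (r *) * ≡ r
    *-reverses     : ∀ r s → r ≤ s → (s *) ≤ (r *)

  infix 4 _<_
  _<_ : Carrier → Carrier → Set
  r < s = (r ≤ s) × (r ≢ s)

  IsOrientationOf : Carrier → Carrier → Set
  IsOrientationOf a r = (a ≡ r) ⊎ (a ≡ r *)

  -- r and s determine the same separation ({r, r*} = {s, s*})
  SameSeparation : Carrier → Carrier → Set
  SameSeparation r s = IsOrientationOf s r

  Nested : Carrier → Carrier → Set
  Nested r s = Σ Carrier λ a → Σ Carrier λ b →
    IsOrientationOf a r × IsOrientationOf b s × ((a ≤ b) ⊎ (b ≤ a))

  Degenerate : Carrier → Set
  Degenerate r = r ≡ r *

  Trivial : Carrier → Set
  Trivial r = Σ Carrier λ s → ¬ SameSeparation r s × (r < s) × (r < (s *))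

  Small : Carrier → Set
  Small r = r ≤ (r *)

  IsTreeSet : Set
  IsTreeSet = (∀ r s → Nested r s) × (∀ r → ¬ Degenerate r) × (∀ r → ¬ Trivial r)

  IsRegular : Set
  IsRegular = ∀ r → ¬ Small r

  FiniteSubset : Pred Carrier lzero → Set
  FiniteSubset P = Σ ℕ λ n → Σ (Fin n → Carrier) λ f →
    ∀ x → P x → Σ (Fin n) λ i → f i ≡ x

  InfiniteSubset : Pred Carrier lzero → Set
  InfiniteSubset P = ¬ FiniteSubset P

  -- S is infinite (equivalently S⃗ is infinite)
  IsInfinite : Set
  IsInfinite = InfiniteSubset (λ _ → ⊤)

  IsOrientation : Pred Carrier lzero → Set
  IsOrientation O = ∀ r → (O r ⊎ O (r *)) × ¬ (O r × O (r *))

  IsConsistent : Pred Carrier lzero → Set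
  IsConsistent O = ∀ a b → ¬ SameSeparation a b → a < b → ¬ (O (a *) × O b)

  IsStar : Pred Carrier lzero → Set
  IsStar σ = ∀ r s → σ r → σ s → r ≢ s → r ≤ (s *)

  IsMaximalIn : Pred Carrier lzero → Carrier → Set
  IsMaximalIn O x = O x × (∀ y → O y → x ≤ y → y ≡ x)

  IsSplittingStar : Pred Carrier lzero → Set₁
  IsSplittingStar σ = IsStar σ × Σ (Pred Carrier lzero) λ O →
    IsOrientation O × IsConsistent O ×
    (∀ x → σ x ⇔ IsMaximalIn O x) ×
    (∀ x → O x ⇔ (Σ Carrier λ s → σ s × (x ≤ s)))

  -- an ω-chain: a strictly increasing sequence (its image is a chain
  -- order-isomorphic to ω)
  IsOmegaChain : (ℕ → Carrier) → Set
  IsOmegaChain f = ∀ m n → m <ℕ n → f m < f n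

  HasOmegaChain : Set
  HasOmegaChain = Σ (ℕ → Carrier) IsOmegaChain

  HasInfiniteSplittingStar : Set₁
  HasInfiniteSplittingStar =
    Σ (Pred Carrier lzero) λ σ → IsSplittingStar σ × InfiniteSubset σ

module Submission where

-- We argue classically and assume that there is no ω-chain.  The involution
-- turns descending chains into ascending ones, so there are no infinite
-- descending chains either; hence whenever r < y there is an upper cover s
-- of r (r < s with nothing strictly in between) with s ≤ y.
--   * As S is infinite and nested, some r has infinitely many elements above.
--   * If every element had only finitely many upper covers, then every r with
--     infinitely many elements above it would have an upper cover with the
--     same property (a finite union of finite sets is finite); iterating this
--     would produce an ω-chain.
--   * So some r has infinitely many upper covers s, and
--     σ = {r} ∪ {s* : s covers r} is an infinite splitting star, witnessed by
--     its down-closure as consistent orientation.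

open import Defs
open import Level using (Level) renaming (zero to lzero)
open import Axiom.DoubleNegationElimination using (em⇒dne)
open import Data.Sum as Sum using (_⊎_; inj₁; inj₂; [_,_])
open import Data.Product using (Σ; _×_; _,_; proj₁; proj₂)
open import Data.Nat using (zero; suc; _+_; s≤s)
open import Data.Nat.GeneralisedArithmetic using (fold)
open import Data.Nat.Properties using (m≤n⇒m<n∨m≡n)
open import Data.Fin as Fin using (Fin; _↑ˡ_; _↑ʳ_; splitAt)
open import Data.Fin.Properties using (splitAt-↑ˡ; splitAt-↑ʳ)
open import Data.Empty using (⊥; ⊥-elim)
open import Function using (id; _∘_)
open import Function.Bundles using (_⇔_; mk⇔)
open import Relation.Nullary using (¬_; yes; no)
open import Relation.Unary using (Pred)
open import Relation.Binary.PropositionalEquality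
  using (_≡_; refl; sym; trans; cong; subst; subst₂)
open import Relation.Binary.Structures using (IsPartialOrder)

module SeparationFacts (S : SeparationSystem) where
  open SeparationSystem S public renaming (_≤_ to _≤₀_)

  -- The order of S, with a fixity that lets us write  a ≤ b * .
  infix 4 _≤_
  _≤_ : Carrier → Carrier → Set
  _≤_ = _≤₀_

  private
    module PO = IsPartialOrder isPartialOrder
    variable
      a b c : Carrier

  ≤-refl : a ≤ a
  ≤-refl = PO.refl

  ≤-trans : a ≤ b → b ≤ c → a ≤ c
  ≤-trans = PO.trans

  ≤-antisym : a ≤ b → b ≤ a → a ≡ b
  ≤-antisym = PO.antisym

  *-injective : a * ≡ b * → a ≡ b
  *-injective {a} {b} e = trans (sym (*-involutive a)) (trans (cong _* e) (*-involutive b))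

  ≤-flip : a ≤ b → b * ≤ a *
  ≤-flip = *-reverses _ _

  ≤-flipˡ : a * ≤ b → b * ≤ a
  ≤-flipˡ {a} p = subst (_ ≤_) (*-involutive a) (≤-flip p)

  ≤-flipʳ : a ≤ b * → b ≤ a *
  ≤-flipʳ {b = b} p = subst (_≤ _) (*-involutive b) (≤-flip p)

  ≤-flip* : a * ≤ b * → b ≤ a
  ≤-flip* {a} {b} p = subst₂ _≤_ (*-involutive b) (*-involutive a) (≤-flip p)

  <-flip : a < b → b * < a *
  <-flip (p , a≢b) = ≤-flip p , λ e → a≢b (*-injective (sym e))

  <-flipˡ : a * < b → b * < a
  <-flipˡ {a} (p , ne) = ≤-flipˡ p , λ e → ne (trans (cong _* (sym e)) (*-involutive _))

  <-flipʳ : a < b * → b < a *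
  <-flipʳ {a} (p , ne) = ≤-flipʳ p , λ e → ne (trans (sym (*-involutive a)) (cong _* (sym e)))

  <-≤-trans : a < b → b ≤ c → a < c
  <-≤-trans (p , a≢b) q = ≤-trans p q , λ { refl → a≢b (≤-antisym p q) }

  <-trans : a < b → b < c → a < c
  <-trans p (q , _) = <-≤-trans p q

  nested-cases : Nested a b → (a ≤ b) ⊎ (b ≤ a) ⊎ (a ≤ b *) ⊎ (a * ≤ b)
  nested-cases (_ , _ , inj₁ refl , inj₁ refl , inj₁ p) = inj₁ p
  nested-cases (_ , _ , inj₁ refl , inj₁ refl , inj₂ p) = inj₂ (inj₁ p)
  nested-cases (_ , _ , inj₁ refl , inj₂ refl , inj₁ p) = inj₂ (inj₂ (inj₁ p))
  nested-cases (_ , _ , inj₁ refl , inj₂ refl , inj₂ p) = inj₂ (inj₂ (inj₂ (≤-flipˡ p)))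
  nested-cases (_ , _ , inj₂ refl , inj₁ refl , inj₁ p) = inj₂ (inj₂ (inj₂ p))
  nested-cases (_ , _ , inj₂ refl , inj₁ refl , inj₂ p) = inj₂ (inj₂ (inj₁ (≤-flipʳ p)))
  nested-cases (_ , _ , inj₂ refl , inj₂ refl , inj₁ p) = inj₂ (inj₁ (≤-flip* p))
  nested-cases (_ , _ , inj₂ refl , inj₂ refl , inj₂ p) = inj₁ (≤-flip* p)

  Above : Carrier → Pred Carrier lzero
  Above r s = r < s

  Cover : Carrier → Pred Carrier lzero
  Cover r s = r < s × (∀ t → r < t → t ≤ s → t ≡ s)

  finite-∅ : {P : Pred Carrier lzero} → (∀ x → ¬ P x) → FiniteSubset P
  finite-∅ empty = 0 , (λ ()) , λ x p → ⊥-elim (empty x p)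

  finite-singleton : ∀ a → FiniteSubset (λ x → x ≡ a)
  finite-singleton a = 1 , (λ _ → a) , λ x x≡a → Fin.zero , sym x≡a

  finite-⊆ : {P Q : Pred Carrier lzero} →
    (∀ x → P x → Q x) → FiniteSubset Q → FiniteSubset P
  finite-⊆ P⊆Q (n , f , covers) = n , f , λ x p → covers x (P⊆Q x p)

  finite-∪ : {P Q : Pred Carrier lzero} →
    FiniteSubset P → FiniteSubset Q → FiniteSubset (λ x → P x ⊎ Q x)
  finite-∪ (m , f , f-covers) (n , g , g-covers) = m + n , h , h-covers
    where
    h : Fin (m + n) → Carrier
    h i = [ f , g ] (splitAt m i)
    h-covers : ∀ x → _ ⊎ _ → Σ (Fin (m + n)) λ i → h i ≡ x
    h-covers x (inj₁ p) with f-covers x p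
    ... | i , refl = i ↑ˡ n , cong [ f , g ] (splitAt-↑ˡ m i n)
    h-covers x (inj₂ q) with g-covers x q
    ... | j , refl = m ↑ʳ j , cong [ f , g ] (splitAt-↑ʳ m n j)

  finite-⋃ : ∀ n (T : Fin n → Pred Carrier lzero) → (∀ i → FiniteSubset (T i)) →
    FiniteSubset (λ x → Σ (Fin n) λ i → T i x)
  finite-⋃ zero T _ = finite-∅ λ { x (() , _) }
  finite-⋃ (suc n) T finite-T =
    finite-⊆ split (finite-∪ (finite-T Fin.zero)
                              (finite-⋃ n (λ i → T (Fin.suc i)) (λ i → finite-T (Fin.suc i))))
    where
    split : ∀ x → Σ (Fin (suc n)) (λ i → T i x) → _ ⊎ _
    split x (Fin.zero , t) = inj₁ t
    split x (Fin.suc i , t) = inj₂ (i , t)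

  finite-preimage-* : {P : Pred Carrier lzero} →
    FiniteSubset P → FiniteSubset (λ x → P (x *))
  finite-preimage-* (n , f , covers) = n , (λ i → f i *) , covers*
    where
    covers* : ∀ x → _ → Σ (Fin n) λ i → f i * ≡ x
    covers* x p with covers (x *) p
    ... | i , fi≡x* = i , trans (cong _* fi≡x*) (*-involutive x)

  increasing-orbit : {A : Set} (val : A → Carrier) (step : A → A) (a : A) →
    (∀ x → val x < val (step x)) → IsOmegaChain (λ n → val (fold a step n))
  increasing-orbit val step a increases m (suc n) (s≤s m≤n) with m≤n⇒m<n∨m≡n m≤n
  ... | inj₂ refl = increases (fold a step m)
  ... | inj₁ m<n = <-trans (increasing-orbit val step a increases m n m<n)
                           (increases (fold a step n))

module Classical (lem : ∀ {ℓ : Level} → ExcludedMiddle ℓ) (S : SeparationSystem) where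
  open SeparationFacts S

  private
    variable
      a b r t y : Carrier

  dne : ∀ {ℓ} {P : Set ℓ} → ¬ ¬ P → P
  dne = em⇒dne lem

  ≤⇒≡⊎< : a ≤ b → a ≡ b ⊎ a < b
  ≤⇒≡⊎< {a} {b} a≤b with lem {P = a ≡ b}
  ... | yes a≡b = inj₁ a≡b
  ... | no a≢b = inj₂ (a≤b , a≢b)

  between-of-non-cover : r < t → ¬ Cover r t → Σ Carrier λ t' → r < t' × t' < t
  between-of-non-cover r<t not-cover = dne λ nothing-between →
    not-cover (r<t , λ t' r<t' t'≤t →
      dne λ t'≢t → nothing-between (t' , r<t' , t'≤t , t'≢t))

  InfinitelyAbove : Carrier → Set
  InfinitelyAbove r = InfiniteSubset (Above r)

  module NestedSystem (nested : ∀ a b → Nested a b) where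

    Near : Carrier → Pred Carrier lzero
    Near r x = x ≡ r ⊎ r < x ⊎ r * < x

    -- Since x is nested with r, x or x* is near r.
    near-or-dual-near : ∀ r x → Near r x ⊎ Near r (x *)
    near-or-dual-near r x with nested-cases (nested x r)
    ... | inj₁ x≤r =
      [ (λ x≡r → inj₁ (inj₁ x≡r)) , (λ x<r → inj₂ (inj₂ (inj₂ (<-flip x<r)))) ] (≤⇒≡⊎< x≤r)
    ... | inj₂ (inj₁ r≤x) =
      [ (λ r≡x → inj₁ (inj₁ (sym r≡x))) , (λ r<x → inj₁ (inj₂ (inj₁ r<x))) ] (≤⇒≡⊎< r≤x)
    ... | inj₂ (inj₂ (inj₁ x≤r*)) =
      [ (λ x≡r* → inj₂ (inj₁ (trans (cong _* x≡r*) (*-involutive r))))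
      , (λ x<r* → inj₂ (inj₂ (inj₁ (<-flipʳ x<r*)))) ] (≤⇒≡⊎< x≤r*)
    ... | inj₂ (inj₂ (inj₂ x*≤r)) =
      [ (λ x*≡r → inj₂ (inj₁ x*≡r)) , (λ x*<r → inj₁ (inj₂ (inj₂ (<-flipˡ x*<r)))) ] (≤⇒≡⊎< x*≤r)

    infinitely-above-some : IsInfinite → Σ Carrier InfinitelyAbove
    infinitely-above-some infinite with lem {P = Carrier}
    ... | no empty = ⊥-elim (infinite (finite-∅ λ x _ → empty x))
    ... | yes r = dne λ none →
      let finite-above : ∀ a → FiniteSubset (Above a)
          finite-above a = dne λ infinite-a → none (a , infinite-a)
          finite-near : FiniteSubset (Near r)
          finite-near = finite-∪ (finite-singleton r)
                          (finite-∪ (finite-above r) (finite-above (r *)))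
      in infinite (finite-⊆ (λ x _ → near-or-dual-near r x)
                            (finite-∪ finite-near (finite-preimage-* finite-near)))

  module WithoutOmegaChain (no-ω-chain : ¬ HasOmegaChain) where

    no-increasing-orbit : {A : Set} (val : A → Carrier) (step : A → A) → A →
      (∀ x → val x < val (step x)) → ⊥
    no-increasing-orbit val step a increases =
      no-ω-chain (_ , increasing-orbit val step a increases)

    no-decreasing-orbit : {A : Set} (val : A → Carrier) (step : A → A) → A →
      (∀ x → val (step x) < val x) → ⊥
    no-decreasing-orbit val step a decreases =
      no-increasing-orbit (λ x → val x *) step a (λ x → <-flip (decreases x))

    cover-below : r < y → Σ Carrier λ s → Cover r s × s ≤ y
    cover-below {r} {y} r<y = dne refute
      where
      Between : Set
      Between = Σ Carrier λ t → r < t × t ≤ y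
      refute : ¬ (Σ Carrier λ s → Cover r s × s ≤ y) → ⊥
      refute no-cover =
        no-decreasing-orbit proj₁ (proj₁ ∘ smaller) (y , r<y , ≤-refl) (proj₂ ∘ smaller)
        where
        -- none of them covers r, so each has a smaller one
        smaller : (x : Between) → Σ Between λ x' → proj₁ x' < proj₁ x
        smaller (t , r<t , t≤y)
          with between-of-non-cover r<t (λ cover → no-cover (t , cover , t≤y))
        ... | t' , r<t' , t'<t = (t' , r<t' , ≤-trans (proj₁ t'<t) t≤y) , t'<t

    -- If r has finitely many upper covers, each with finitely many elements
    -- above it, then only finitely many elements lie above r: each of them is
    -- a cover or above one.
    finite-above-from-covers : FiniteSubset (Cover r) →
      (∀ s → Cover r s → FiniteSubset (Above s)) → FiniteSubset (Above r)
    finite-above-from-covers {r} (n , f , f-covers) finite-above-cover =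
      finite-⊆ through-cover (finite-⋃ n Reach finite-reach)
      where
      Reach : Fin n → Pred Carrier lzero
      Reach i x = x ≡ f i ⊎ (Cover r (f i) × f i < x)
      finite-reach : ∀ i → FiniteSubset (Reach i)
      finite-reach i with lem {P = Cover r (f i)}
      ... | yes cover = finite-⊆ (λ x → Sum.map₂ proj₂)
                          (finite-∪ (finite-singleton (f i)) (finite-above-cover (f i) cover))
      ... | no not-cover = finite-⊆ (λ x → [ id , (λ reach → ⊥-elim (not-cover (proj₁ reach))) ])
                             (finite-singleton (f i))
      through-cover : ∀ x → r < x → Σ (Fin n) λ i → Reach i x
      through-cover x r<x with cover-below r<x
      ... | s , cover , s≤x with f-covers s cover
      ...   | i , refl = i , Sum.map₁ sym (Sum.map₂ (cover ,_) (≤⇒≡⊎< s≤x))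

    infinitely-above-cover : FiniteSubset (Cover r) → InfinitelyAbove r →
      Σ Carrier λ s → Cover r s × InfinitelyAbove s
    infinitely-above-cover finite-covers infinite-above = dne λ none →
      infinite-above (finite-above-from-covers finite-covers λ s cover →
        dne λ infinite-s → none (s , cover , infinite-s))

    -- In an infinite nested system some element has infinitely many upper
    -- covers: otherwise climbing from cover to cover gives an ω-chain.
    infinitely-many-covers : (∀ a b → Nested a b) → IsInfinite →
      Σ Carrier λ r → InfiniteSubset (Cover r)
    infinitely-many-covers nested infinite = dne λ none →
      climb (λ r → dne λ infinite-r → none (r , infinite-r))
      where
      climb : (∀ r → FiniteSubset (Cover r)) → ⊥
      climb finite-covers =
        no-increasing-orbit proj₁ (proj₁ ∘ higher) (NestedSystem.infinitely-above-some nested infinite)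
          (proj₂ ∘ higher)
        where
        higher : (x : Σ Carrier InfinitelyAbove) →
          Σ (Σ Carrier InfinitelyAbove) λ x' → proj₁ x < proj₁ x'
        higher (r , infinite-r) with infinitely-above-cover (finite-covers r) infinite-r
        ... | s , cover , infinite-s = (s , infinite-s) , proj₁ cover

    module Star (tree : IsTreeSet) (regular : IsRegular) (r : Carrier) where

      nested : ∀ a b → Nested a b
      nested = proj₁ tree

      not-co-small : a * ≤ a → ⊥
      not-co-small {a} a*≤a = regular (a *) (subst (a * ≤_) (sym (*-involutive a)) a*≤a)

      -- Non-triviality: nothing lies strictly below both orientations of b.
      not-below-both : a < b → a < b * → ⊥
      not-below-both {a} {b} a<b a<b* = proj₂ (proj₂ tree) a (b , distinct , a<b , a<b*)
        where
        distinct : ¬ SameSeparation a b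
        distinct (inj₁ b≡a) = proj₂ a<b (sym b≡a)
        distinct (inj₂ b≡a*) = proj₂ a<b* (sym (trans (cong _* b≡a*) (*-involutive a)))

      σ : Pred Carrier lzero
      σ x = x ≡ r ⊎ Cover r (x *)

      O : Pred Carrier lzero
      O x = Σ Carrier λ s → σ s × x ≤ s

      dual-cover-in-σ : Cover r t → σ (t *)
      dual-cover-in-σ {t} cover = inj₂ (subst (Cover r) (sym (*-involutive t)) cover)

      -- Two distinct covers of r are incomparable and not below each other's
      -- inverse, so by nestedness their inverses are comparable as a star needs.
      is-star : IsStar σ
      is-star x y (inj₁ refl) (inj₁ refl) x≢y = ⊥-elim (x≢y refl)
      is-star x y (inj₁ refl) (inj₂ cover-y*) _ = proj₁ (proj₁ cover-y*)
      is-star x y (inj₂ cover-x*) (inj₁ refl) _ = ≤-flipʳ (proj₁ (proj₁ cover-x*))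
      is-star x y (inj₂ (r<x* , x*-min)) (inj₂ (r<y* , y*-min)) x≢y
        with nested-cases (nested (x *) (y *))
      ... | inj₁ x*≤y* = ⊥-elim (x≢y (*-injective (y*-min (x *) r<x* x*≤y*)))
      ... | inj₂ (inj₁ y*≤x*) = ⊥-elim (x≢y (*-injective (sym (x*-min (y *) r<y* y*≤x*))))
      ... | inj₂ (inj₂ (inj₁ x*≤y**)) =
        ⊥-elim (not-below-both r<y* (<-≤-trans r<x* x*≤y**))
      ... | inj₂ (inj₂ (inj₂ x**≤y*)) = subst (_≤ y *) (*-involutive x) x**≤y*

      σ-no-pair : σ a → σ (a *) → ⊥
      σ-no-pair {a} (inj₁ a≡r) (inj₁ a*≡r) = proj₁ (proj₂ tree) a (trans a≡r (sym a*≡r))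
      σ-no-pair {a} (inj₁ a≡r) (inj₂ cover) = proj₂ (proj₁ cover) (sym (trans (*-involutive a) a≡r))
      σ-no-pair (inj₂ cover) (inj₁ a*≡r) = proj₂ (proj₁ cover) (sym a*≡r)
      σ-no-pair (inj₂ cover) (inj₂ cover') = not-below-both (proj₁ cover) (proj₁ cover')

      star-or-equal : ∀ p q → σ p → σ q → p ≡ q ⊎ p ≤ q *
      star-or-equal p q σp σq with lem {P = p ≡ q}
      ... | yes p≡q = inj₁ p≡q
      ... | no p≢q = inj₂ (is-star p q σp σq p≢q)

      -- Every y ≥ r is oriented by O: y itself if y = r, otherwise y* lies
      -- below the inverse of a cover of r below y.
      orient-above : r ≤ y → O y ⊎ O (y *)
      orient-above r≤y with ≤⇒≡⊎< r≤y
      ... | inj₁ refl = inj₁ (r , inj₁ refl , ≤-refl)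
      ... | inj₂ r<y with cover-below r<y
      ...   | s , cover , s≤y = inj₂ (s * , dual-cover-in-σ cover , ≤-flip s≤y)

      -- O is an orientation: it contains x or x* (by nestedness with r) ...
      O-total : ∀ x → O x ⊎ O (x *)
      O-total x with nested-cases (nested x r)
      ... | inj₁ x≤r = inj₁ (r , inj₁ refl , x≤r)
      ... | inj₂ (inj₁ r≤x) = orient-above r≤x
      ... | inj₂ (inj₂ (inj₁ x≤r*)) =
        [ inj₂ , (λ O-x** → inj₁ (subst O (*-involutive x) O-x**)) ] (orient-above (≤-flipʳ x≤r*))
      ... | inj₂ (inj₂ (inj₂ x*≤r)) = inj₂ (r , inj₁ refl , x*≤r)

      -- ... but never both, by the star property and regularity.
      O-antisymmetric : ∀ x → ¬ (O x × O (x *))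
      O-antisymmetric x ((p , σp , x≤p) , (q , σq , x*≤q)) with star-or-equal p q σp σq
      ... | inj₁ refl = not-co-small (≤-trans (≤-flip x≤p) x*≤q)
      ... | inj₂ p≤q* = σ-no-pair σq (subst σ (≤-antisym p≤q* (≤-trans (≤-flipˡ x*≤q) x≤p)) σp)

      -- If a < b with a* ≤ p and b ≤ q in σ, then p = q makes p co-small and
      -- otherwise q ≤ p* forces b ≤ a.
      O-consistent : IsConsistent O
      O-consistent a b _ (a≤b , a≢b) ((p , σp , a*≤p) , (q , σq , b≤q)) with star-or-equal q p σq σp
      ... | inj₁ refl = not-co-small (≤-trans (≤-flipˡ a*≤p) (≤-trans a≤b b≤q))
      ... | inj₂ q≤p* = a≢b (≤-antisym a≤b (≤-trans b≤q (≤-trans q≤p* (≤-flipˡ a*≤p))))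

      -- The maximal elements of O are exactly those of σ: an element of σ below
      -- another element of O would be small.
      σ-maximal : ∀ x → σ x ⇔ IsMaximalIn O x
      σ-maximal x = mk⇔ maximal in-σ
        where
        in-σ : IsMaximalIn O x → σ x
        in-σ ((p , σp , x≤p) , max) = subst σ (max p (p , σp , ≤-refl) x≤p) σp
        maximal : σ x → IsMaximalIn O x
        maximal σx = (x , σx , ≤-refl) , above-is-equal
          where
          above-is-equal : ∀ y → O y → x ≤ y → y ≡ x
          above-is-equal y (p , σp , y≤p) x≤y with star-or-equal x p σx σp
          ... | inj₁ refl = ≤-antisym y≤p x≤y
          ... | inj₂ x≤p* = ⊥-elim (regular x (≤-trans x≤p* (≤-flip (≤-trans x≤y y≤p))))

      is-splitting-star : IsSplittingStar σ
      is-splitting-star = is-star , O , (λ x → O-total x , O-antisymmetric x) , O-consistent ,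
        σ-maximal , (λ x → mk⇔ id id)

      -- σ contains the inverses of all covers of r.
      σ-infinite : InfiniteSubset (Cover r) → InfiniteSubset σ
      σ-infinite infinite-covers finite-σ =
        infinite-covers (finite-⊆ (λ _ → dual-cover-in-σ) (finite-preimage-* finite-σ))

lemma3p5 : (lem : ∀ {ℓ : Level} → ExcludedMiddle ℓ) (S : SeparationSystem) →
    let open SeparationSystem S in
    IsTreeSet → IsRegular → IsInfinite →
    HasOmegaChain ⊎ HasInfiniteSplittingStar
lemma3p5 lem S tree regular infinite with lem {P = SeparationSystem.HasOmegaChain S}
... | yes ω-chain = inj₁ ω-chain
... | no no-ω-chain = inj₂ (σ , is-splitting-star , σ-infinite (proj₂ many-covers))
  where
  open SeparationFacts S
  open Classical.WithoutOmegaChain lem S no-ω-chain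
  many-covers : Σ Carrier λ r → InfiniteSubset (Cover r)
  many-covers = infinitely-many-covers (proj₁ tree) infinite
  open Star tree regular (proj₁ many-covers)
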